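{- Let $\mathsf{P}$ be a finite graded poset of rank $r$, let $F$ be an order filter of $\mathsf{P}$, let $0\le i\le r$ and let $p\in\mathsf{P}$ have rank $i$. Then $p\in\mathrm{rvac}_{\mathcal{F}}(F)$ if and only if $p\in\mathrm{row}_{\mathcal{F}}^{\,i+1}(F)$.
   Context: A finite poset $\mathsf{P}$ is graded of rank $r$ if there is $\mathrm{rk}\colon\mathsf{P}\to\mathbb{Z}_{\ge0}$ with $\mathrm{rk}(x)=0$ for minimal $x$, $\mathrm{rk}(y)=\mathrm{rk}(x)+1$ whenever $y$ covers $x$, and $\mathrm{rk}(x)=r$ for maximal $x$; $\mathsf{P}_i=\{p:\mathrm{rk}(p)=i\}$. For $p\in\mathsf{P}$ the order filter toggle $t_p$ acts on order filters (up-closed subsets) $F$ by: $t_p(F)=F\cup\{p\}$ if $p\notin F$ and $F\cup\{p\}$ is an order filter; $t_p(F)=F\setminus\{p\}$ if $p\in F$ and $F\setminus\{p\}$ is an order filter; $t_p(F)=F$ otherwise. The rank toggle is $\mathbf{t}_i=\prod_{p\in\mathsf{P}_i}t_p$ (the factors commute). Products of maps denote composition with the rightmost applied first. Rowmotion is $\mathrm{row}_{\mathcal{F}}=\mathbf{t}_0\mathbf{t}_1\cdots\mathbf{t}_r$ (equivalently, $\mathrm{row}_{\mathcal{F}}(F)$ is the complement of the order ideal generated by the minimal elements of $F$), and rowvacuation is $\mathrm{rvac}_{\mathcal{F}}=(\mathbf{t}_r)(\mathbf{t}_{r-1}\mathbf{t}_r)\cdots(\mathbf{t}_1\mathbf{t}_2\cdots\mathbf{t}_r)(\mathbf{t}_0\mathbf{t}_1\cdots\mathbf{t}_r)$.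 -}

module Defs where

open import Level using (0ℓ)
open import Data.Nat using (ℕ; zero; suc; _+_; _∸_)
open import Data.Bool using (Bool; true; false; if_then_else_)
open import Data.Fin using (Fin; _≟_)
open import Data.Fin.Properties using (all?)
open import Data.List using (List; []; _∷_; map; upTo; reverse; foldr)
open import Data.Product using (_×_; ∃)
open import Function using (_∘_; id)
open import Relation.Nullary using (¬_; Dec; does; yes; no)
open import Relation.Nullary.Decidable using (_→-dec_)
open import Relation.Binary using (Rel; Decidable; IsDecPartialOrder)
open import Relation.Binary.PropositionalEquality using (_≡_)

Subset : ℕ → Set
Subset n = Fin n → Bool

_∈_ : ∀ {n} → Fin n → Subset n → Set
p ∈ F = F p ≡ true

insert : ∀ {n} → Fin n → Subset n → Subset n
insert p F x with x ≟ p
... | yes _ = true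
... | no _ = F x

remove : ∀ {n} → Fin n → Subset n → Subset n
remove p F x with x ≟ p
... | yes _ = false
... | no _ = F x

module _ {n : ℕ} (_≼_ : Rel (Fin n) 0ℓ) (≼-dec : Decidable _≼_) where

  IsFilter : Subset n → Set
  IsFilter F = ∀ x y → x ≼ y → x ∈ F → y ∈ F

  isFilter? : (F : Subset n) → Dec (IsFilter F)
  isFilter? F = all? λ x → all? λ y →
    ≼-dec x y →-dec (Data.Bool._≟_ (F x) true →-dec Data.Bool._≟_ (F y) true)

  toggle : Fin n → Subset n → Subset n
  toggle p F with F p
  ... | true  = if does (isFilter? (remove p F)) then remove p F else F
  ... | false = if does (isFilter? (insert p F)) then insert p F else F

  module _ (rk : Fin n → ℕ) where

    -- rank toggle t_i : product of t_p over p of rank i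
    -- (applied in the order of Fin n; the factors commute on filters)
    rankToggle : ℕ → Subset n → Subset n
    rankToggle i F = foldr (λ p G → if does (rk p Data.Nat.≟ i) then toggle p G else G)
                           F (Data.List.allFin n)

    compose : List (Subset n → Subset n) → Subset n → Subset n
    compose = foldr (λ f g → f ∘ g) id

    -- t_j t_{j+1} ⋯ t_r  (t_r applied first)
    segment : ℕ → ℕ → Subset n → Subset n
    segment r j = compose (map (λ k → rankToggle (j + k)) (upTo (suc r ∸ j)))

    row : ℕ → Subset n → Subset n
    row r = segment r 0

    -- rvac = (t_r)(t_{r-1} t_r) ⋯ (t_1 ⋯ t_r)(t_0 ⋯ t_r)
    rvac : ℕ → Subset n → Subset n
    rvac r = compose (map (segment r) (reverse (upTo (suc r))))

module _ {n : ℕ} (_≼_ : Rel (Fin n) 0ℓ) where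

  _≺_ : Fin n → Fin n → Set
  x ≺ y = x ≼ y × ¬ (x ≡ y)

  _⋖_ : Fin n → Fin n → Set
  x ⋖ y = x ≺ y × (∀ z → x ≺ z → ¬ (z ≺ y))

  IsMinimal : Fin n → Set
  IsMinimal x = ∀ y → y ≼ x → y ≡ x

  IsMaximal : Fin n → Set
  IsMaximal x = ∀ y → x ≼ y → y ≡ x

  IsGradedRank : (Fin n → ℕ) → ℕ → Set
  IsGradedRank rk r =
      (∀ x → IsMinimal x → rk x ≡ 0)
    × (∀ x y → x ⋖ y → rk y ≡ suc (rk x))
    × (∀ x → IsMaximal x → rk x ≡ r)

iterate : ∀ {A : Set} → ℕ → (A → A) → A → A
iterate zero f = id
iterate (suc k) f = f ∘ iterate k f

{-# OPTIONS --safe #-}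
-- Toggles t p and t q commute on order filters unless p and q are related by a cover, so
-- the rank toggles 𝐭 i and 𝐭 j commute unless i and j are adjacent. Splitting
-- row = (𝐭 0 ⋯ 𝐭 k)(𝐭 (k+1) ⋯ 𝐭 r) and inducting on k gives
--   row^(k+1) = staircase k ∘ (𝐭 k ⋯ 𝐭 r) ⋯ (𝐭 0 ⋯ 𝐭 r),
-- with staircase k = (𝐭 0 ⋯ 𝐭 (k-1)) ⋯ (𝐭 0 𝐭 1)(𝐭 0): the new factor 𝐭 (k+1) ⋯ 𝐭 r commutes
-- past the staircase, which only toggles ranks below k. At an element of rank i neither
-- staircase i nor the remaining factors (𝐭 j ⋯ 𝐭 r), j > i, of rvac change anything.
-- Without function extensionality, maps on subsets are compared pointwise (_≈_).
module Submission where

open import Defs hiding (_≺_; _⋖_)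
import Defs as D
open import Level using (0ℓ)
open import Data.Bool as Bool using (true; false; if_then_else_; not)
open import Data.Bool.Properties using (¬-not)
open import Data.Empty using (⊥-elim)
open import Data.Fin as Fin using (Fin)
open import Data.Fin.Properties using (any?; all?)
open import Data.List using (List; []; _∷_; foldr; allFin; map; applyUpTo; downFrom)
open import Data.List.Properties using (map-applyUpTo; reverse-upTo)
open import Data.Nat as ℕ using (ℕ; zero; suc; _+_; _∸_; _≤_; _<_; _≤′_; ≤′-refl; ≤′-step; s≤s)
open import Data.Nat.Properties
  using (<⇒≢; <⇒≤; m<n⇒m<1+n; m≤n⇒m≤1+n; n≤1+n; ≤-refl; ≤-trans; <-≤-trans; m≤m+n; +-suc;
         +-identityʳ; m+[n∸m]≡n; ≤′⇒≤; ≤⇒≤′)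
open import Data.Product using (_×_; _,_; ∃-syntax; proj₁; proj₂)
open import Data.Sum using (_⊎_; inj₁; inj₂)
open import Function using (_∘_; id)
open import Function.Bundles using (_⇔_; mk⇔; Equivalence)
open import Relation.Binary using (Rel; Decidable; IsDecPartialOrder)
open import Relation.Binary.PropositionalEquality
  using (_≡_; _≢_; ≢-sym; refl; sym; trans; cong; cong₂; subst; module ≡-Reasoning)
open import Relation.Nullary using (¬_; Dec; does; yes; no; ¬?)
open import Relation.Nullary.Decidable using (_×-dec_; _→-dec_; dec-true; dec-false)

b≡true⇒b≢false : ∀ {b} → b ≡ true → b ≢ false
b≡true⇒b≢false refl ()

module _ {n : ℕ} (q : Fin n) (F : Subset n) where

  remove-≡ : remove q F q ≡ false
  remove-≡ with q Fin.≟ q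
  ... | yes _ = refl
  ... | no q≢q = ⊥-elim (q≢q refl)

  remove-≢ : ∀ {x} → x ≢ q → remove q F x ≡ F x
  remove-≢ {x} x≢q with x Fin.≟ q
  ... | yes x≡q = ⊥-elim (x≢q x≡q)
  ... | no _ = refl

  insert-≡ : insert q F q ≡ true
  insert-≡ with q Fin.≟ q
  ... | yes _ = refl
  ... | no q≢q = ⊥-elim (q≢q refl)

  insert-≢ : ∀ {x} → x ≢ q → insert q F x ≡ F x
  insert-≢ {x} x≢q with x Fin.≟ q
  ... | yes x≡q = ⊥-elim (x≢q x≡q)
  ... | no _ = refl

  ∈-remove : ∀ {x} → x ∈ remove q F → x ≢ q × x ∈ F
  ∈-remove {x} x∈F∖q with x Fin.≟ q
  ... | no x≢q = x≢q , x∈F∖q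

  ∈-insert : ∀ {x} → x ∈ insert q F → x ≡ q ⊎ x ∈ F
  ∈-insert {x} x∈F∪q with x Fin.≟ q
  ... | yes x≡q = inj₁ x≡q
  ... | no _ = inj₂ x∈F∪q

module Toggles {n : ℕ} (_≼_ : Rel (Fin n) 0ℓ) (_≼?_ : Decidable _≼_) where

  open ≡-Reasoning

  _≺_ _⋖_ : Rel (Fin n) 0ℓ
  _≺_ = D._≺_ _≼_
  _⋖_ = D._⋖_ _≼_

  Filter : Subset n → Set
  Filter = IsFilter _≼_ _≼?_

  t : Fin n → Subset n → Subset n
  t = toggle _≼_ _≼?_

  _≈_ : Subset n → Subset n → Set
  F ≈ G = ∀ x → F x ≡ G x

  Toggleable : Fin n → Subset n → Set
  Toggleable q F = (∀ z → z ≺ q → F z ≡ false) × (∀ z → q ≺ z → F z ≡ true)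

  _≺?_ : Decidable _≺_
  x ≺? y = (x ≼? y) ×-dec ¬? (x Fin.≟ y)

  toggleable? : ∀ q F → Dec (Toggleable q F)
  toggleable? q F = all? (λ z → z ≺? q →-dec (F z Bool.≟ false))
             ×-dec all? (λ z → q ≺? z →-dec (F z Bool.≟ true))

  toggleable-resp : ∀ {q F G} → F ≈ G → Toggleable q F → Toggleable q G
  toggleable-resp F≈G (below , above) =
    (λ z z≺q → trans (sym (F≈G z)) (below z z≺q)) , (λ z q≺z → trans (sym (F≈G z)) (above z q≺z))

  filter-resp : ∀ {F G} → F ≈ G → Filter F → Filter G
  filter-resp F≈G f x y x≼y y∈G = trans (sym (F≈G y)) (f x y x≼y (trans (F≈G x) y∈G))

  ifFilter : Subset n → Subset n → Subset n
  ifFilter X F = if does (isFilter? _≼_ _≼?_ X) then X else F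

  ifFilter-yes : ∀ {X} F → Filter X → ifFilter X F ≡ X
  ifFilter-yes {X} F fX = cong (if_then X else F) (dec-true (isFilter? _≼_ _≼?_ X) fX)

  ifFilter-no : ∀ {X} F → ¬ Filter X → ifFilter X F ≡ F
  ifFilter-no {X} F ¬fX = cong (if_then X else F) (dec-false (isFilter? _≼_ _≼?_ X) ¬fX)

  ifFilter-filter : ∀ X {F} → Filter F → Filter (ifFilter X F)
  ifFilter-filter X {F} fF with isFilter? _≼_ _≼?_ X
  ... | yes fX = subst Filter (sym (ifFilter-yes F fX)) fX
  ... | no ¬fX = subst Filter (sym (ifFilter-no F ¬fX)) fF

  ifFilter-agrees : ∀ X F {x} → X x ≡ F x → ifFilter X F x ≡ F x
  ifFilter-agrees X F X≡F with does (isFilter? _≼_ _≼?_ X)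
  ... | true = X≡F
  ... | false = refl

  remove-filter : ∀ {q F} → Filter F → Toggleable q F → Filter (remove q F)
  remove-filter {q} {F} fF (below , _) x y x≼y x∈F∖q with ∈-remove q F {x} x∈F∖q | y Fin.≟ q
  ... | x≢q , x∈F | yes refl = ⊥-elim (b≡true⇒b≢false x∈F (below x (x≼y , x≢q)))
  ... | _ , x∈F | no _ = fF x y x≼y x∈F

  insert-filter : ∀ {q F} → Filter F → Toggleable q F → Filter (insert q F)
  insert-filter {q} {F} fF (_ , above) x y x≼y x∈F∪q with y Fin.≟ q | ∈-insert q F {x} x∈F∪q
  ... | yes refl | _ = refl
  ... | no y≢q | inj₁ refl = above y (x≼y , λ q≡y → y≢q (sym q≡y))
  ... | no _ | inj₂ x∈F = fF x y x≼y x∈F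

  remove-filter⁻¹ : ∀ {q F} → Filter F → q ∈ F → Filter (remove q F) → Toggleable q F
  remove-filter⁻¹ {q} {F} fF q∈F fF∖q = below , λ z q≺z → fF q z (proj₁ q≺z) q∈F
    where
    below : ∀ z → z ≺ q → F z ≡ false
    below z (z≼q , z≢q) = ¬-not λ z∈F →
      b≡true⇒b≢false (fF∖q z q z≼q (trans (remove-≢ q F z≢q) z∈F)) (remove-≡ q F)

  insert-filter⁻¹ : ∀ {q F} → Filter F → F q ≡ false → Filter (insert q F) → Toggleable q F
  insert-filter⁻¹ {q} {F} fF q∉F fF∪q = below , above
    where
    below : ∀ z → z ≺ q → F z ≡ false
    below z (z≼q , _) = ¬-not λ z∈F → b≡true⇒b≢false (fF z q z≼q z∈F) q∉F
    above : ∀ z → q ≺ z → F z ≡ true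
    above z (q≼z , q≢z) = trans (sym (insert-≢ q F λ z≡q → q≢z (sym z≡q))) (fF∪q q z q≼z (insert-≡ q F))

  toggle-≢ : ∀ q F {x} → x ≢ q → t q F x ≡ F x
  toggle-≢ q F x≢q with F q
  ... | true = ifFilter-agrees (remove q F) F (remove-≢ q F x≢q)
  ... | false = ifFilter-agrees (insert q F) F (insert-≢ q F x≢q)

  toggle-filter : ∀ q {F} → Filter F → Filter (t q F)
  toggle-filter q {F} fF with F q
  ... | true = ifFilter-filter (remove q F) fF
  ... | false = ifFilter-filter (insert q F) fF

  toggle-toggleable : ∀ {q F} → Filter F → Toggleable q F → t q F q ≡ not (F q)
  toggle-toggleable {q} {F} fF tq with F q
  ... | true = trans (cong (λ G → G q) (ifFilter-yes F (remove-filter fF tq))) (remove-≡ q F)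
  ... | false = trans (cong (λ G → G q) (ifFilter-yes F (insert-filter fF tq))) (insert-≡ q F)

  toggle-untoggleable : ∀ {q F} → Filter F → ¬ Toggleable q F → t q F ≡ F
  toggle-untoggleable {q} {F} fF ¬tq with F q in q∈?F
  ... | true = ifFilter-no F λ fF∖q → ¬tq (remove-filter⁻¹ fF q∈?F fF∖q)
  ... | false = ifFilter-no F λ fF∪q → ¬tq (insert-filter⁻¹ fF q∈?F fF∪q)

  toggle-cong : ∀ q {F G} → Filter F → F ≈ G → t q F ≈ t q G
  toggle-cong q {F} {G} fF F≈G x with x Fin.≟ q
  ... | no x≢q = trans (toggle-≢ q F x≢q) (trans (F≈G x) (sym (toggle-≢ q G x≢q)))
  ... | yes refl with toggleable? q F
  ...   | yes tq = begin
    t q F q   ≡⟨ toggle-toggleable fF tq ⟩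
    not (F q) ≡⟨ cong not (F≈G q) ⟩
    not (G q) ≡⟨ toggle-toggleable fG (toggleable-resp F≈G tq) ⟨
    t q G q   ∎
    where
    fG : Filter G
    fG = filter-resp F≈G fF
  ...   | no ¬tq = begin
    t q F q ≡⟨ cong (λ H → H q) (toggle-untoggleable fF ¬tq) ⟩
    F q     ≡⟨ F≈G q ⟩
    G q     ≡⟨ cong (λ H → H q) (toggle-untoggleable fG (¬tq ∘ toggleable-resp (sym ∘ F≈G))) ⟨
    t q G q ∎
    where
    fG : Filter G
    fG = filter-resp F≈G fF

  _≈[_]_ : Subset n → Fin n → Subset n → Set
  F ≈[ c ] G = ∀ {x} → x ≢ c → F x ≡ G x

  interval : ∀ {p q} → p ≺ q → ¬ p ⋖ q → ∃[ w ] p ≺ w × w ≺ q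
  interval {p} {q} p≺q ¬p⋖q with any? (λ w → (p ≺? w) ×-dec (w ≺? q))
  ... | yes between = between
  ... | no ¬between = ⊥-elim (¬p⋖q (p≺q , λ w p≺w w≺q → ¬between (w , p≺w , w≺q)))

  -- An element strictly between c and u would lie in F, being above c, and outside G,
  -- being below u.
  toggleables-incomparable : ∀ {c u F G} → F ≈[ c ] G → Toggleable c F → Toggleable u G →
                             ¬ c ⋖ u → ¬ u ⋖ c → ¬ c ≺ u × ¬ u ≺ c
  toggleables-incomparable {c} {u} F≈G (belowᶜ , aboveᶜ) (belowᵘ , aboveᵘ) ¬c⋖u ¬u⋖c =
    not-below , not-above
    where
    not-below : ¬ c ≺ u
    not-below c≺u with interval c≺u ¬c⋖u
    ... | w , c≺w , w≺u =
      b≡true⇒b≢false (aboveᶜ w c≺w) (trans (F≈G (proj₂ c≺w ∘ sym)) (belowᵘ w w≺u))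
    not-above : ¬ u ≺ c
    not-above u≺c with interval u≺c ¬u⋖c
    ... | w , u≺w , w≺c =
      b≡true⇒b≢false (aboveᵘ w u≺w) (trans (sym (F≈G (proj₂ w≺c))) (belowᶜ w w≺c))

  toggleable-transfer : ∀ {c u F G} → F ≈[ c ] G → ¬ c ≺ u → ¬ u ≺ c →
                        Toggleable u F → Toggleable u G
  toggleable-transfer {c} F≈G ¬c≺u ¬u≺c (below , above) =
    (λ z z≺u → trans (sym (F≈G (z≢c z≺u ¬c≺u))) (below z z≺u)) ,
    (λ z u≺z → trans (sym (F≈G (z≢c u≺z ¬u≺c))) (above z u≺z))
    where
    z≢c : ∀ {z} {R : Fin n → Set} → R z → ¬ R c → z ≢ c
    z≢c Rz ¬Rc refl = ¬Rc Rz

  toggleable-after-toggle : ∀ {p q F} → ¬ p ⋖ q → ¬ q ⋖ p → Filter F →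
                            Toggleable p (t q F) ⇔ Toggleable p F
  toggleable-after-toggle {p} {q} {F} ¬p⋖q ¬q⋖p fF with toggleable? q F
  ... | no ¬tq rewrite toggle-untoggleable fF ¬tq = mk⇔ id id
  ... | yes tq = mk⇔ to from
    where
    tqF≈F : t q F ≈[ q ] F
    tqF≈F = toggle-≢ q F
    to : Toggleable p (t q F) → Toggleable p F
    to tp = let ¬q≺p , ¬p≺q = toggleables-incomparable (sym ∘ tqF≈F) tq tp ¬q⋖p ¬p⋖q
            in toggleable-transfer tqF≈F ¬q≺p ¬p≺q tp
    from : Toggleable p F → Toggleable p (t q F)
    from tp = let ¬q≺p , ¬p≺q = toggleables-incomparable (λ _ → refl) tq tp ¬q⋖p ¬p⋖q
              in toggleable-transfer (sym ∘ tqF≈F) ¬q≺p ¬p≺q tp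

  toggle-after-toggle : ∀ {p q F} → p ≢ q → ¬ p ⋖ q → ¬ q ⋖ p → Filter F →
                        t p (t q F) p ≡ t p F p
  toggle-after-toggle {p} {q} {F} p≢q ¬p⋖q ¬q⋖p fF with toggleable? p F
  ... | yes tp = begin
    t p (t q F) p ≡⟨ toggle-toggleable (toggle-filter q fF) (Equivalence.from tp⇔ tp) ⟩
    not (t q F p) ≡⟨ cong not (toggle-≢ q F p≢q) ⟩
    not (F p)     ≡⟨ toggle-toggleable fF tp ⟨
    t p F p       ∎
    where
    tp⇔ : Toggleable p (t q F) ⇔ Toggleable p F
    tp⇔ = toggleable-after-toggle ¬p⋖q ¬q⋖p fF
  ... | no ¬tp = begin
    t p (t q F) p ≡⟨ cong (λ G → G p) (toggle-untoggleable (toggle-filter q fF) (¬tp ∘ Equivalence.to tp⇔)) ⟩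
    t q F p       ≡⟨ toggle-≢ q F p≢q ⟩
    F p           ≡⟨ cong (λ G → G p) (toggle-untoggleable fF ¬tp) ⟨
    t p F p       ∎
    where
    tp⇔ : Toggleable p (t q F) ⇔ Toggleable p F
    tp⇔ = toggleable-after-toggle ¬p⋖q ¬q⋖p fF

  toggle-comm : ∀ {p q F} → ¬ p ⋖ q → ¬ q ⋖ p → Filter F → t p (t q F) ≈ t q (t p F)
  toggle-comm {p} {q} {F} ¬p⋖q ¬q⋖p fF x with p Fin.≟ q | x Fin.≟ p | x Fin.≟ q
  ... | yes refl | _ | _ = refl
  ... | no p≢q | yes refl | _ =
    trans (toggle-after-toggle p≢q ¬p⋖q ¬q⋖p fF) (sym (toggle-≢ q (t p F) p≢q))
  ... | no p≢q | no x≢p | yes refl =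
    trans (toggle-≢ p (t q F) x≢p) (sym (toggle-after-toggle (p≢q ∘ sym) ¬q⋖p ¬p⋖q fF))
  ... | no _ | no x≢p | no x≢q = begin
    t p (t q F) x ≡⟨ toggle-≢ p (t q F) x≢p ⟩
    t q F x       ≡⟨ toggle-≢ q F x≢q ⟩
    F x           ≡⟨ toggle-≢ p F x≢p ⟨
    t p F x       ≡⟨ toggle-≢ q (t p F) x≢q ⟨
    t q (t p F) x ∎

  Op : Set
  Op = Subset n → Subset n

  record IsFilterMap (f : Op) : Set where
    field
      preserves : ∀ {F} → Filter F → Filter (f F)
      cong-≈ : ∀ {F G} → Filter F → F ≈ G → f F ≈ f G

  open IsFilterMap public

  record Commute (f g : Op) : Set where
    constructor mkCommute
    field commute : ∀ {F} → Filter F → f (g F) ≈ g (f F)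

  open Commute public

  id-filterMap : IsFilterMap id
  id-filterMap = record { preserves = id ; cong-≈ = λ _ F≈G → F≈G }

  ∘-filterMap : ∀ {f g} → IsFilterMap f → IsFilterMap g → IsFilterMap (f ∘ g)
  ∘-filterMap f-fm g-fm = record
    { preserves = preserves f-fm ∘ preserves g-fm
    ; cong-≈ = λ fF F≈G → cong-≈ f-fm (preserves g-fm fF) (cong-≈ g-fm fF F≈G)
    }

  toggle-filterMap : ∀ q → IsFilterMap (t q)
  toggle-filterMap q = record { preserves = toggle-filter q ; cong-≈ = toggle-cong q }

  iterate-filterMap : ∀ {f} k → IsFilterMap f → IsFilterMap (iterate k f)
  iterate-filterMap zero f-fm = id-filterMap
  iterate-filterMap (suc k) f-fm = ∘-filterMap f-fm (iterate-filterMap k f-fm)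

  commute-sym : ∀ {f g} → Commute f g → Commute g f
  commute-sym f∘g≈g∘f = mkCommute λ fF x → sym (commute f∘g≈g∘f fF x)

  commute-id : ∀ {f} → Commute f id
  commute-id = mkCommute λ _ _ → refl

  commute-∘ʳ : ∀ {f g h} → IsFilterMap f → IsFilterMap g → IsFilterMap h →
               Commute f g → Commute f h → Commute f (g ∘ h)
  commute-∘ʳ {f} {g} {h} f-fm g-fm h-fm fg fh = mkCommute λ {F} fF x → begin
    f (g (h F)) x ≡⟨ commute fg (preserves h-fm fF) x ⟩
    g (f (h F)) x ≡⟨ cong-≈ g-fm (preserves f-fm (preserves h-fm fF)) (commute fh fF) x ⟩
    g (h (f F)) x ∎

  commute-∘ˡ : ∀ {f g h} → IsFilterMap f → IsFilterMap g → IsFilterMap h →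
               Commute f h → Commute g h → Commute (f ∘ g) h
  commute-∘ˡ f-fm g-fm h-fm fh gh =
    commute-sym (commute-∘ʳ h-fm f-fm g-fm (commute-sym fh) (commute-sym gh))

module Ranked {n : ℕ} (_≼_ : Rel (Fin n) 0ℓ) (_≼?_ : Decidable _≼_) (rk : Fin n → ℕ)
  (rk-cover : ∀ x y → D._⋖_ _≼_ x y → rk y ≡ suc (rk x)) where

  open Toggles _≼_ _≼?_
  open ≡-Reasoning

  𝐭 : ℕ → Op
  𝐭 = rankToggle _≼_ _≼?_ rk

  toggleIf : ∀ {P : Set} → Dec P → Fin n → Op
  toggleIf P? p G = if does P? then t p G else G

  togglesOfRank : ℕ → List (Fin n) → Op
  togglesOfRank i ps F = foldr (λ p → toggleIf (rk p ℕ.≟ i) p) F ps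

  toggleIf-filterMap : ∀ {P} (P? : Dec P) p → IsFilterMap (toggleIf P? p)
  toggleIf-filterMap (yes _) p = toggle-filterMap p
  toggleIf-filterMap (no _) p = id-filterMap

  toggleIf-commute : ∀ {P g} (P? : Dec P) p → (P → Commute (t p) g) → Commute (toggleIf P? p) g
  toggleIf-commute (yes P-holds) p commutes = commutes P-holds
  toggleIf-commute (no _) p commutes = commute-sym commute-id

  togglesOfRank-filterMap : ∀ i ps → IsFilterMap (togglesOfRank i ps)
  togglesOfRank-filterMap i [] = id-filterMap
  togglesOfRank-filterMap i (p ∷ ps) =
    ∘-filterMap (toggleIf-filterMap (rk p ℕ.≟ i) p) (togglesOfRank-filterMap i ps)

  togglesOfRank-≢ : ∀ i ps {F x} → rk x ≢ i → togglesOfRank i ps F x ≡ F x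
  togglesOfRank-≢ i [] rkx≢i = refl
  togglesOfRank-≢ i (p ∷ ps) {F} {x} rkx≢i =
    trans (step (rk p ℕ.≟ i)) (togglesOfRank-≢ i ps rkx≢i)
    where
    G : Subset n
    G = togglesOfRank i ps F
    step : (rkp≟i : Dec (rk p ≡ i)) → toggleIf rkp≟i p G x ≡ G x
    step (yes rkp≡i) = toggle-≢ p G λ x≡p → rkx≢i (trans (cong rk x≡p) rkp≡i)
    step (no _) = refl

  togglesOfRank-commute : ∀ {g} i ps → IsFilterMap g → (∀ p → rk p ≡ i → Commute (t p) g) →
                          Commute (togglesOfRank i ps) g
  togglesOfRank-commute i [] g-fm commutes = commute-sym commute-id
  togglesOfRank-commute i (p ∷ ps) g-fm commutes =
    commute-∘ˡ (toggleIf-filterMap (rk p ℕ.≟ i) p) (togglesOfRank-filterMap i ps) g-fm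
      (toggleIf-commute (rk p ℕ.≟ i) p (commutes p)) (togglesOfRank-commute i ps g-fm commutes)

  rankToggle-filterMap : ∀ i → IsFilterMap (𝐭 i)
  rankToggle-filterMap i = togglesOfRank-filterMap i (allFin n)

  rankToggle-≢ : ∀ i {F x} → rk x ≢ i → 𝐭 i F x ≡ F x
  rankToggle-≢ i = togglesOfRank-≢ i (allFin n)

  rankToggle-commute : ∀ {i j} → i ≢ suc j → j ≢ suc i → Commute (𝐭 i) (𝐭 j)
  rankToggle-commute {i} {j} i≢1+j j≢1+i =
    togglesOfRank-commute i (allFin n) (rankToggle-filterMap j) λ p rkp≡i →
      commute-sym (togglesOfRank-commute j (allFin n) (toggle-filterMap p) λ q rkq≡j →
        mkCommute (toggle-comm
          (λ q⋖p → i≢1+j (trans (sym rkp≡i) (trans (rk-cover q p q⋖p) (cong suc rkq≡j))))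
          (λ p⋖q → j≢1+i (trans (sym rkq≡j) (trans (rk-cover p q p⋖q) (cong suc rkp≡i))))))

  sweep : ℕ → ℕ → Op
  sweep zero j = id
  sweep (suc m) j = 𝐭 j ∘ sweep m (suc j)

  sweep-filterMap : ∀ m j → IsFilterMap (sweep m j)
  sweep-filterMap zero j = id-filterMap
  sweep-filterMap (suc m) j = ∘-filterMap (rankToggle-filterMap j) (sweep-filterMap m (suc j))

  sweep-fixes-below : ∀ m j {F x} → rk x < j → sweep m j F x ≡ F x
  sweep-fixes-below zero j rkx<j = refl
  sweep-fixes-below (suc m) j rkx<j =
    trans (rankToggle-≢ j (<⇒≢ rkx<j)) (sweep-fixes-below m (suc j) (m<n⇒m<1+n rkx<j))

  sweep-fixes-above : ∀ m j {F x} → j + m ≤ rk x → sweep m j F x ≡ F x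
  sweep-fixes-above zero j j≤rkx = refl
  sweep-fixes-above (suc m) j {x = x} j+1+m≤rkx =
    trans (rankToggle-≢ j (≢-sym (<⇒≢ (≤-trans (s≤s (m≤m+n j m)) j+m<rkx))))
          (sweep-fixes-above m (suc j) j+m<rkx)
    where
    j+m<rkx : j + m < rk x
    j+m<rkx = subst (_≤ rk x) (+-suc j m) j+1+m≤rkx

  sweep-+ : ∀ a b j → sweep (a + b) j ≡ sweep a j ∘ sweep b (j + a)
  sweep-+ zero b j = cong (sweep b) (sym (+-identityʳ j))
  sweep-+ (suc a) b j = cong (𝐭 j ∘_) (begin
    sweep (a + b) (suc j)                 ≡⟨ sweep-+ a b (suc j) ⟩
    sweep a (suc j) ∘ sweep b (suc j + a) ≡⟨ cong (λ k → sweep a (suc j) ∘ sweep b k) (sym (+-suc j a)) ⟩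
    sweep a (suc j) ∘ sweep b (j + suc a) ∎)

  rankToggle-sweep-commute : ∀ {i} m j → suc (suc i) ≤ j → Commute (𝐭 i) (sweep m j)
  rankToggle-sweep-commute zero j i+2≤j = commute-id
  rankToggle-sweep-commute {i} (suc m) j i+2≤j =
    commute-∘ʳ (rankToggle-filterMap i) (rankToggle-filterMap j) (sweep-filterMap m (suc j))
      (rankToggle-commute (<⇒≢ (m<n⇒m<1+n i<j)) (≢-sym (<⇒≢ i+2≤j)))
      (rankToggle-sweep-commute m (suc j) (m≤n⇒m≤1+n i+2≤j))
    where
    i<j : i < j
    i<j = ≤-trans (n≤1+n (suc i)) i+2≤j

  sweep-commute : ∀ m a m′ b → suc (a + m) ≤ b → Commute (sweep m a) (sweep m′ b)
  sweep-commute zero a m′ b _ = commute-sym commute-id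
  sweep-commute (suc m) a m′ b a+m+2≤b =
    commute-∘ˡ (rankToggle-filterMap a) (sweep-filterMap m (suc a)) (sweep-filterMap m′ b)
      (rankToggle-sweep-commute m′ b (≤-trans (s≤s (s≤s (m≤m+n a m))) a+m+2≤b′))
      (sweep-commute m (suc a) m′ b a+m+2≤b′)
    where
    a+m+2≤b′ : suc (suc (a + m)) ≤ b
    a+m+2≤b′ = subst (λ k → suc k ≤ b) (+-suc a m) a+m+2≤b

  staircase : ℕ → Op
  staircase zero = id
  staircase (suc k) = sweep (suc k) 0 ∘ staircase k

  staircase-filterMap : ∀ k → IsFilterMap (staircase k)
  staircase-filterMap zero = id-filterMap
  staircase-filterMap (suc k) = ∘-filterMap (sweep-filterMap (suc k) 0) (staircase-filterMap k)

  staircase-fixes : ∀ k {F x} → k ≤ rk x → staircase k F x ≡ F x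
  staircase-fixes zero k≤rkx = refl
  staircase-fixes (suc k) k<rkx =
    trans (sweep-fixes-above (suc k) 0 k<rkx) (staircase-fixes k (<⇒≤ k<rkx))

  staircase-sweep-commute : ∀ k m b → suc k ≤ b → Commute (staircase k) (sweep m b)
  staircase-sweep-commute zero m b _ = commute-sym commute-id
  staircase-sweep-commute (suc k) m b k+2≤b =
    commute-∘ˡ (sweep-filterMap (suc k) 0) (staircase-filterMap k) (sweep-filterMap m b)
      (sweep-commute (suc k) 0 m b k+2≤b) (staircase-sweep-commute k m b (<⇒≤ k+2≤b))

  compose-sweep : ∀ m j (f : ℕ → Op) → (∀ k → f k ≡ 𝐭 (j + k)) →
                  compose _≼_ _≼?_ rk (applyUpTo f m) ≡ sweep m j
  compose-sweep zero j f f≡𝐭 = refl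
  compose-sweep (suc m) j f f≡𝐭 = cong₂ (λ g h → g ∘ h)
    (trans (f≡𝐭 0) (cong 𝐭 (+-identityʳ j)))
    (compose-sweep m (suc j) (f ∘ suc) λ k → trans (f≡𝐭 (suc k)) (cong 𝐭 (+-suc j k)))

  module _ (r : ℕ) where

    segmentʳ : ℕ → Op
    segmentʳ = segment _≼_ _≼?_ rk r

    rowmotion rowvacuation : Op
    rowmotion = row _≼_ _≼?_ rk r
    rowvacuation = rvac _≼_ _≼?_ rk r

    segment-sweep : ∀ j → segmentʳ j ≡ sweep (suc r ∸ j) j
    segment-sweep j = trans
      (cong (compose _≼_ _≼?_ rk) (map-applyUpTo id (λ k → 𝐭 (j + k)) (suc r ∸ j)))
      (compose-sweep (suc r ∸ j) j (λ k → 𝐭 (j + k)) λ _ → refl)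

    segment-filterMap : ∀ j → IsFilterMap (segmentʳ j)
    segment-filterMap j = subst IsFilterMap (sym (segment-sweep j)) (sweep-filterMap (suc r ∸ j) j)

    rowmotion-filterMap : IsFilterMap rowmotion
    rowmotion-filterMap = segment-filterMap 0

    rowmotion-split : ∀ {k} → k ≤ r → rowmotion ≡ sweep (suc k) 0 ∘ segmentʳ (suc k)
    rowmotion-split {k} k≤r = begin
      rowmotion                               ≡⟨ segment-sweep 0 ⟩
      sweep (suc r) 0                         ≡⟨ cong (λ m → sweep (suc m) 0) (sym (m+[n∸m]≡n k≤r)) ⟩
      sweep (suc k + (r ∸ k)) 0               ≡⟨ sweep-+ (suc k) (r ∸ k) 0 ⟩
      sweep (suc k) 0 ∘ sweep (r ∸ k) (suc k) ≡⟨ cong (sweep (suc k) 0 ∘_) (segment-sweep (suc k)) ⟨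
      sweep (suc k) 0 ∘ segmentʳ (suc k)      ∎

    rvacUpTo : ℕ → Op
    rvacUpTo zero = id
    rvacUpTo (suc k) = segmentʳ k ∘ rvacUpTo k

    rowvacuation-rvacUpTo : rowvacuation ≡ rvacUpTo (suc r)
    rowvacuation-rvacUpTo = trans
      (cong (λ ks → compose _≼_ _≼?_ rk (map segmentʳ ks)) (reverse-upTo (suc r)))
      (compose-downFrom (suc r))
      where
      compose-downFrom : ∀ k → compose _≼_ _≼?_ rk (map segmentʳ (downFrom k)) ≡ rvacUpTo k
      compose-downFrom zero = refl
      compose-downFrom (suc k) = cong (segmentʳ k ∘_) (compose-downFrom k)

    rvacUpTo-fixes : ∀ {j k F x} → rk x < j → j ≤′ k → rvacUpTo k F x ≡ rvacUpTo j F x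
    rvacUpTo-fixes rkx<j ≤′-refl = refl
    rvacUpTo-fixes {j} {suc k} {F} {x} rkx<j (≤′-step j≤′k) = begin
      segmentʳ k (rvacUpTo k F) x             ≡⟨ cong (λ f → f (rvacUpTo k F) x) (segment-sweep k) ⟩
      sweep (suc r ∸ k) k (rvacUpTo k F) x    ≡⟨ sweep-fixes-below (suc r ∸ k) k (<-≤-trans rkx<j (≤′⇒≤ j≤′k)) ⟩
      rvacUpTo k F x                          ≡⟨ rvacUpTo-fixes rkx<j j≤′k ⟩
      rvacUpTo j F x                          ∎

    rvacUpTo-filterMap : ∀ k → IsFilterMap (rvacUpTo k)
    rvacUpTo-filterMap zero = id-filterMap
    rvacUpTo-filterMap (suc k) = ∘-filterMap (segment-filterMap k) (rvacUpTo-filterMap k)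

    segment-staircase-commute : ∀ k → Commute (segmentʳ (suc k)) (staircase k)
    segment-staircase-commute k = subst (λ f → Commute f (staircase k)) (sym (segment-sweep (suc k)))
      (commute-sym (staircase-sweep-commute k (r ∸ k) (suc k) ≤-refl))

    iterate-rowmotion : ∀ {k} → k ≤ r → ∀ {F} → Filter F →
                        iterate (suc k) rowmotion F ≈ staircase k (rvacUpTo (suc k) F)
    iterate-rowmotion {zero} _ _ _ = refl
    iterate-rowmotion {suc k} k<r {F} fF x = begin
      rowmotion (iterate (suc k) rowmotion F) x
        ≡⟨ cong-≈ rowmotion-filterMap (preserves (iterate-filterMap (suc k) rowmotion-filterMap) fF)
                  (iterate-rowmotion (<⇒≤ k<r) fF) x ⟩
      rowmotion (staircase k G) x
        ≡⟨ cong (λ f → f (staircase k G) x) (rowmotion-split (<⇒≤ k<r)) ⟩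
      sweep (suc k) 0 (segmentʳ (suc k) (staircase k G)) x
        ≡⟨ cong-≈ (sweep-filterMap (suc k) 0) (preserves (segment-filterMap (suc k)) (preserves (staircase-filterMap k) fG))
             (commute (segment-staircase-commute k) fG) x ⟩
      sweep (suc k) 0 (staircase k (segmentʳ (suc k) G)) x ∎
      where
      G : Subset n
      G = rvacUpTo (suc k) F
      fG : Filter G
      fG = preserves (rvacUpTo-filterMap (suc k)) fF

proposition2p11 : (n : ℕ) (_≼_ : Rel (Fin n) 0ℓ) (po : IsDecPartialOrder _≡_ _≼_)
    (rk : Fin n → ℕ) (r : ℕ) → IsGradedRank _≼_ rk r →
    (F : Subset n) → IsFilter _≼_ (IsDecPartialOrder._≤?_ po) F →
    (i : ℕ) → i ≤ r → (p : Fin n) → rk p ≡ i →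
    (p ∈ rvac _≼_ (IsDecPartialOrder._≤?_ po) rk r F)
      ⇔ (p ∈ iterate (suc i) (row _≼_ (IsDecPartialOrder._≤?_ po) rk r) F)
proposition2p11 n _≼_ po rk r (_ , rk-cover , _) F fF i i≤r p refl =
  mk⇔ (trans (sym rvac≡row)) (trans rvac≡row)
  where
  open Ranked _≼_ (IsDecPartialOrder._≤?_ po) rk rk-cover
  open ≡-Reasoning
  rvac≡row : rowvacuation r F p ≡ iterate (suc i) (rowmotion r) F p
  rvac≡row = begin
    rowvacuation r F p                   ≡⟨ cong (λ f → f F p) (rowvacuation-rvacUpTo r) ⟩
    rvacUpTo r (suc r) F p               ≡⟨ rvacUpTo-fixes r ≤-refl (≤⇒≤′ (s≤s i≤r)) ⟩
    rvacUpTo r (suc i) F p               ≡⟨ staircase-fixes i ≤-refl ⟨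
    staircase i (rvacUpTo r (suc i) F) p ≡⟨ iterate-rowmotion r i≤r fF p ⟨
    iterate (suc i) (rowmotion r) F p    ∎
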